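{- Let $\mathcal C$ be a Lipschitz seminorm category with terminal object $\mathbf 1$. Then for every object $X$ and every generalised point $p\in\mathcal C(\mathbf 1,X)$ one has $|p|=\bot$.
   Context: $(\mathcal V,\otimes,e)$ is a quantale: complete lattice with bottom $\bot$, top $\top$, commutative monoid $(\otimes,e)$ with $x\otimes-$ preserving joins (so $x\otimes\bot=\bot$). A seminorm space is a complete $\mathcal V$-space $A$ (symmetric distance $d\colon A\times A\to\mathcal V$ with $d(a,a)=\bot$, in which every geometric sequence has a unique limit point) with a map $|\cdot|\colon A\to\mathcal V$. A seminorm category is a category enriched in the monoidal category $\mathbf{SNorm}$ of seminorm spaces (morphisms: nonexpansive maps with $|f(a)|\le|a|$; tensor: product with max-distance and seminorm $|(a,b)|=|a|\otimes|b|$); its morphisms are the elements of the hom-objects, and composition satisfies $|g\circ f|\le|g|\otimes|f|$. A terminal object $\mathbf 1$ is an object with $\mathcal C(X,\mathbf 1)$ a single point of seminorm $\bot$ for every $X$. $\mathcal C$ is a Lipschitz category if $|\mathrm{id}_{\mathbf 1}|=\bot$. A generalised point of $X$ is a morphism $\mathbf 1\to X$. -}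

module Defs where

open import Level using (Level; _⊔_; suc)
open import Data.Bool using (Bool; true; false)
open import Data.Product using (_×_; _,_; Σ)
open import Relation.Binary.PropositionalEquality using (_≡_)

record Quantale (c ℓ ι : Level) : Set (suc (c ⊔ ℓ ⊔ ι)) where
  infix  4 _≤_
  infixl 7 _⊗_
  field
    V        : Set c
    _≤_      : V → V → Set ℓ
    ≤-refl   : ∀ {x} → x ≤ x
    ≤-trans  : ∀ {x y z} → x ≤ y → y ≤ z → x ≤ z
    ≤-antisym : ∀ {x y} → x ≤ y → y ≤ x → x ≡ y
    ⋁        : {I : Set ι} → (I → V) → V
    ⋁-upper  : ∀ {I : Set ι} (f : I → V) (i : I) → f i ≤ ⋁ f
    ⋁-least  : ∀ {I : Set ι} (f : I → V) (u : V) → (∀ i → f i ≤ u) → ⋁ f ≤ u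
    ⊥ ⊤      : V
    ⊥-least  : ∀ x → ⊥ ≤ x
    ⊤-greatest : ∀ x → x ≤ ⊤
    _⊗_      : V → V → V
    e        : V
    ⊗-assoc  : ∀ x y z → (x ⊗ y) ⊗ z ≡ x ⊗ (y ⊗ z)
    ⊗-comm   : ∀ x y → x ⊗ y ≡ y ⊗ x
    ⊗-identityˡ : ∀ x → e ⊗ x ≡ x
    ⊗-⋁      : ∀ x {I : Set ι} (f : I → V) → x ⊗ ⋁ f ≡ ⋁ (λ i → x ⊗ f i)

module _ {c ℓ ι} (Q : Quantale c ℓ ι) where
  open Quantale Q

  _∨_ : V → V → V
  x ∨ y = ⋁ {I = Level.Lift ι Bool} (λ { (Level.lift true) → x ; (Level.lift false) → y })

  record SNormSpace (a : Level) : Set (c ⊔ ℓ ⊔ suc a) where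
    field
      Carrier : Set a
      d       : Carrier → Carrier → V
      d-refl  : ∀ x → d x x ≡ ⊥
      d-sym   : ∀ x y → d x y ≡ d y x
      ∣_∣     : Carrier → V

  open SNormSpace

  -- Tensor of seminorm spaces: product, max-distance, seminorm |(a,b)| = |a| ⊗ |b|.
  -- A map A ⊗ B → C is a morphism of SNorm iff it is nonexpansive for the
  -- max-distance and does not increase seminorms.
  record SNormBimorphism {a b k} (A : SNormSpace a) (B : SNormSpace b) (C : SNormSpace k)
                         : Set (a ⊔ b ⊔ k ⊔ ℓ) where
    field
      fun       : Carrier A → Carrier B → Carrier C
      nonexp    : ∀ x x' y y' →
                  d C (fun x y) (fun x' y') ≤ (d A x x' ∨ d B y y')
      seminorm  : ∀ x y → ∣ C ∣ (fun x y) ≤ (∣ A ∣ x ⊗ ∣ B ∣ y)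

  -- The monoidal unit of SNorm is the
  -- one-point space with seminorm e, so a morphism  I → C(X,X)  picking out
  -- id_X amounts to  |id_X| ≤ e.
  record SNormCategory (o a : Level) : Set (c ⊔ ℓ ⊔ suc (o ⊔ a)) where
    field
      Obj   : Set o
      Hom   : Obj → Obj → SNormSpace a
      id    : ∀ X → Carrier (Hom X X)
      id-norm : ∀ X → ∣ Hom X X ∣ (id X) ≤ e
      comp  : ∀ X Y Z → SNormBimorphism (Hom Y Z) (Hom X Y) (Hom X Z)

    _∘_ : ∀ {X Y Z} → Carrier (Hom Y Z) → Carrier (Hom X Y) → Carrier (Hom X Z)
    _∘_ {X} {Y} {Z} g f = SNormBimorphism.fun (comp X Y Z) g f

    ∣_∣ₕ : ∀ {X Y} → Carrier (Hom X Y) → V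
    ∣_∣ₕ {X} {Y} f = ∣ Hom X Y ∣ f

    field
      identityˡ : ∀ {X Y} (f : Carrier (Hom X Y)) → id Y ∘ f ≡ f
      identityʳ : ∀ {X Y} (f : Carrier (Hom X Y)) → f ∘ id X ≡ f
      assoc     : ∀ {W X Y Z} (h : Carrier (Hom Y Z)) (g : Carrier (Hom X Y))
                  (f : Carrier (Hom W X)) → (h ∘ g) ∘ f ≡ h ∘ (g ∘ f)

  module _ {o a} (𝒞 : SNormCategory o a) where
    open SNormCategory 𝒞

    IsTerminal : Obj → Set (c ⊔ o ⊔ a)
    IsTerminal T = ∀ X → Σ (Carrier (Hom X T)) λ t →
                     (∀ (u : Carrier (Hom X T)) → u ≡ t) × (∣ Hom X T ∣ t ≡ ⊥)

    IsLipschitz : (T : Obj) → Set c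
    IsLipschitz T = ∣ Hom T T ∣ (id T) ≡ ⊥

{-# OPTIONS --safe #-}
module Submission where

open import Defs
open import Data.Empty using () renaming (⊥ to ⊥-type)
open import Level using (Lift)
open import Relation.Binary.PropositionalEquality using (_≡_; sym; subst; cong; module ≡-Reasoning)

-- Since |p ∘ id| ≤ |p| ⊗ |id|, an identity of seminorm ⊥ forces every morphism
-- out of its object to have seminorm ≤ |p| ⊗ ⊥ = ⊥, as ⊥ is the empty join and
-- x ⊗ - preserves joins.

module _ {c ℓ ι} (Q : Quantale c ℓ ι) where
  open Quantale Q

  ≤⊥⇒≡⊥ : ∀ {x} → x ≤ ⊥ → x ≡ ⊥
  ≤⊥⇒≡⊥ x≤⊥ = ≤-antisym x≤⊥ (⊥-least _)

  ⋁-empty : (f : Lift ι ⊥-type → V) → ⋁ f ≡ ⊥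
  ⋁-empty f = ≤⊥⇒≡⊥ (⋁-least f ⊥ λ ())

  ⊗-zeroʳ : ∀ x → x ⊗ ⊥ ≡ ⊥
  ⊗-zeroʳ x = begin
    x ⊗ ⊥                ≡⟨ cong (x ⊗_) (sym (⋁-empty empty)) ⟩
    x ⊗ ⋁ empty          ≡⟨ ⊗-⋁ x empty ⟩
    ⋁ (λ i → x ⊗ empty i) ≡⟨ ⋁-empty _ ⟩
    ⊥                    ∎
    where
      open ≡-Reasoning
      empty : Lift ι ⊥-type → V
      empty ()

  module _ {o a} (𝒞 : SNormCategory Q o a) where
    open SNormCategory 𝒞

    ∣∣ₕ≤∣∣ₕ⊗∣id∣ₕ : ∀ {X Y} (f : SNormSpace.Carrier (Hom X Y)) → ∣ f ∣ₕ ≤ ∣ f ∣ₕ ⊗ ∣ id X ∣ₕ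
    ∣∣ₕ≤∣∣ₕ⊗∣id∣ₕ {X} {Y} f =
      subst (λ g → ∣ g ∣ₕ ≤ ∣ f ∣ₕ ⊗ ∣ id X ∣ₕ) (identityʳ f)
            (SNormBimorphism.seminorm (comp X X Y) f (id X))

    ∣id∣ₕ≡⊥⇒∣∣ₕ≡⊥ : ∀ {X Y} → ∣ id X ∣ₕ ≡ ⊥ → (f : SNormSpace.Carrier (Hom X Y)) → ∣ f ∣ₕ ≡ ⊥
    ∣id∣ₕ≡⊥⇒∣∣ₕ≡⊥ {X} ∣id∣≡⊥ f = ≤⊥⇒≡⊥ (subst (λ z → ∣ f ∣ₕ ≤ z) f⊗id≡⊥ (∣∣ₕ≤∣∣ₕ⊗∣id∣ₕ f))
      where
        f⊗id≡⊥ : ∣ f ∣ₕ ⊗ ∣ id X ∣ₕ ≡ ⊥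
        f⊗id≡⊥ = subst (λ z → ∣ f ∣ₕ ⊗ z ≡ ⊥) (sym ∣id∣≡⊥) (⊗-zeroʳ ∣ f ∣ₕ)

mainTheorem8 : ∀ {c ℓ ι o a} (Q : Quantale c ℓ ι) (𝒞 : SNormCategory Q o a)
    (𝟏 : SNormCategory.Obj 𝒞) → IsTerminal Q 𝒞 𝟏 → IsLipschitz Q 𝒞 𝟏 →
    ∀ (X : SNormCategory.Obj 𝒞) (p : SNormSpace.Carrier (SNormCategory.Hom 𝒞 𝟏 X)) →
    SNormSpace.∣_∣ (SNormCategory.Hom 𝒞 𝟏 X) p ≡ Quantale.⊥ Q
mainTheorem8 Q 𝒞 𝟏 _ lipschitz X p = ∣id∣ₕ≡⊥⇒∣∣ₕ≡⊥ Q 𝒞 lipschitz p
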